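{- Let $m\ge 0$ and $n\ge 1$ be integers. The number $|\mathcal{R}(m,n)|$ of acyclic orientations of the complete bipartite graph $K_{m,n}$ having no sink in the part $L$ of size $m$ equals \[ n!\,n^m-\sum_{j=1}^{n-1}(-1)^{j-1}\,(n-j)!\,(n-j)^m\left\{ {n \atop n-j} \right\}, \] where $\left\{ {a \atop b} \right\}$ is the Stirling number of the second kind.
   Context: $K_{m,n}$ has vertex set $L\cup R$ with $L=\{1,\dots,m\}$, $R=\{m+1,\dots,m+n\}$, and edges all pairs $\{u,v\}$ with $u\in L$, $v\in R$. An acyclic orientation directs every edge so that there is no directed cycle; a sink is a vertex with no outgoing edge. $\mathcal{R}(m,n)$ is the set of acyclic orientations of $K_{m,n}$ in which no vertex of $L$ is a sink. -}

module Defs where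

open import Data.Nat using (ℕ; zero; suc; _*_; _^_; _∸_; _!; _+_)
open import Data.Integer as ℤ using (ℤ; +_)
open import Data.Bool using (Bool; true; false)
open import Data.Fin using (Fin)
open import Data.Vec using (Vec; lookup)
open import Data.Sum using (_⊎_; inj₁; inj₂)
open import Data.Empty using (⊥)
open import Data.Product using (_×_)
open import Relation.Nullary using (¬_)
open import Relation.Binary.PropositionalEquality using (_≡_)
open import Relation.Binary.Construct.Closure.Transitive using (TransClosure)

-- Vertices of K_{m,n}: inj₁ i is the left vertex i+1 ∈ L, inj₂ j is the right
-- vertex m+j+1 ∈ R.
Vertex : ℕ → ℕ → Set
Vertex m n = Fin m ⊎ Fin n

-- An orientation of K_{m,n}: for each edge {i, j} (i ∈ L, j ∈ R) a Bool;
-- true means the edge is directed i → j, false means j → i.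
Orientation : ℕ → ℕ → Set
Orientation m n = Vec (Vec Bool n) m

Arc : ∀ {m n} → Orientation m n → Vertex m n → Vertex m n → Set
Arc o (inj₁ i) (inj₂ j) = lookup (lookup o i) j ≡ true
Arc o (inj₂ j) (inj₁ i) = lookup (lookup o i) j ≡ false
Arc o (inj₁ _) (inj₁ _) = ⊥
Arc o (inj₂ _) (inj₂ _) = ⊥

Acyclic : ∀ {m n} → Orientation m n → Set
Acyclic o = ∀ v → ¬ TransClosure (Arc o) v v

IsSink : ∀ {m n} → Orientation m n → Vertex m n → Set
IsSink o v = ∀ w → ¬ Arc o v w

NoSinkInL : ∀ {m n} → Orientation m n → Set
NoSinkInL {m} o = (i : Fin m) → ¬ IsSink o (inj₁ i)

InR : ∀ {m n} → Orientation m n → Set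
InR o = Acyclic o × NoSinkInL o

stirling2 : ℕ → ℕ → ℕ
stirling2 zero    zero    = 1
stirling2 zero    (suc k) = 0
stirling2 (suc n) zero    = 0
stirling2 (suc n) (suc k) = suc k * stirling2 n (suc k) + stirling2 n k

sumℤ : ℕ → (ℕ → ℤ) → ℤ
sumℤ zero    f = + 0
sumℤ (suc k) f = sumℤ k f ℤ.+ f k

formula : ℕ → ℕ → ℤ
formula m n =
  + ((n !) * n ^ m) ℤ.-
  sumℤ (n ∸ 1) (λ i → let j = suc i in
     (ℤ.- (+ 1)) ℤ.^ i ℤ.* + (((n ∸ j) !) * (n ∸ j) ^ m * stirling2 n (n ∸ j)))

-- Record an orientation by the rows Aᵢ ⊆ R of out-neighbours of the left vertices.  It is acyclic
-- iff the rows form a chain under inclusion (two incomparable rows give a cycle i → j → i′ → j′ → i,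
-- and along a walk the row sizes at left vertices strictly decrease), and no left vertex is a sink iff
-- every row is nonempty.  Attaching labels in {0,…,l}, let X(n,l) count the m-tuples of nonzero
-- elements of 2ⁿ × {0,…,l} forming a chain; then X(0,l) = lᵐ and the answer is X(n,0).  Splitting
-- 2ⁿ⁺¹ = 2 × 2ⁿ, a chain is determined by its 2ⁿ-part together with a threshold on the labels that
-- separates rows with first bit 0 from rows with first bit 1; counting the admissible thresholds gives
-- X(n+1,l) = (l+1)X(n,l+1) − l X(n,l).  Hence X(n,0) = (Δⁿ h)(0) for h(l) = lᵐ and
-- Δh(l) = (l+1)h(l+1) − l h(l), and expanding Δⁿ at 0 produces the coefficients (−1)ⁿ⁻ᵏ S(n,k) k!.

module Submission where

open import Defs
open import Algebra.Bundles using (CommutativeMonoid)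
import Algebra.Properties.CommutativeSemigroup as CommutativeSemigroupProperties
open import Data.Bool using (Bool; true; false; not; _∧_; _∨_; T?)
import Data.Bool.Properties as Boolₚ
open import Data.Empty using (⊥-elim)
open import Data.Fin using (Fin; zero; suc)
open import Data.Integer as ℤ using (ℤ; +_)
import Data.Integer.Properties as ℤₚ
open import Data.Integer.Tactic.RingSolver using (solve-∀)
open import Data.List
  using (List; []; _∷_; _++_; map; length; filterᵇ; cartesianProductWith; cartesianProduct; downFrom)
open import Data.List.Membership.Propositional using (_∈_)
open import Data.List.Membership.Propositional.Properties
  using (∈-filter⁺; ∈-filter⁻; ∈-cartesianProductWith⁺; ∈-cartesianProductWith⁻;
         ∈-cartesianProduct⁺; ∈-cartesianProduct⁻; ∈-downFrom⁺; ∈-downFrom⁻)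
open import Data.List.Properties using (length-removeAt′)
import Data.List.Relation.Unary.All as ListAll
open import Data.List.Relation.Unary.Any using (here; there; _─_)
open import Data.List.Relation.Unary.Unique.Propositional using (Unique; []; _∷_)
import Data.List.Relation.Unary.Unique.Propositional.Properties as Uniqueₚ
open import Data.Nat using (ℕ; zero; suc; pred; _+_; _*_; _^_; _∸_; _!; _⊔_; _≤_; _<_; _≤ᵇ_; s≤s; z≤n)
import Data.Nat.Properties as ℕₚ
open import Data.Product using (Σ; _×_; _,_; proj₁; proj₂)
open import Data.Sum using (inj₁; inj₂)
open import Data.Vec using (Vec; []; _∷_; lookup)
import Data.Vec as Vec
import Data.Vec.Properties as Vecₚ
open import Data.Vec.Relation.Unary.All as AllV using ([]; _∷_) renaming (All to AllV)
import Data.Vec.Relation.Unary.All.Properties as AllVₚ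
open import Function using (_∘_)
open import Function.Bundles using (Equivalence; _⇔_; mk⇔)
open import Relation.Binary.Construct.Closure.Reflexive as Refl using (ReflClosure)
open import Relation.Binary.Construct.Closure.Transitive using (TransClosure; [_]; _∷_)
open import Relation.Binary.PropositionalEquality
  using (_≡_; _≢_; refl; sym; trans; cong; cong₂; subst; subst₂; module ≡-Reasoning)
open import Relation.Nullary using (contradiction)

open CommutativeSemigroupProperties ℕₚ.+-commutativeSemigroup using (interchange; xy∙z≈xz∙y)
open CommutativeSemigroupProperties (CommutativeMonoid.commutativeSemigroup Boolₚ.∧-commutativeMonoid)
  using () renaming (interchange to ∧-interchange; x∙yz≈y∙xz to ∧-swap)

private
  variable
    A B C : Set

∧≡true⁻ : {a b : Bool} → a ∧ b ≡ true → a ≡ true × b ≡ true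
∧≡true⁻ {true} {true} _ = refl , refl

∧≡true⁺ : {a b : Bool} → a ≡ true → b ≡ true → a ∧ b ≡ true
∧≡true⁺ refl refl = refl

≤⇒≤ᵇ≡true : {x y : ℕ} → x ≤ y → (x ≤ᵇ y) ≡ true
≤⇒≤ᵇ≡true = Equivalence.to Boolₚ.T-≡ ∘ ℕₚ.≤⇒≤ᵇ

≤ᵇ≡true⇒≤ : (x y : ℕ) → (x ≤ᵇ y) ≡ true → x ≤ y
≤ᵇ≡true⇒≤ x y = ℕₚ.≤ᵇ⇒≤ x y ∘ Equivalence.from Boolₚ.T-≡

>⇒≤ᵇ≡false : {x y : ℕ} → y < x → (x ≤ᵇ y) ≡ false
>⇒≤ᵇ≡false {x} {y} y<x with x ≤ᵇ y in eq
... | true  = ⊥-elim (ℕₚ.<⇒≱ y<x (≤ᵇ≡true⇒≤ x y eq))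
... | false = refl

≤ᵇ≡false⇒> : (x y : ℕ) → (x ≤ᵇ y) ≡ false → y < x
≤ᵇ≡false⇒> x y eq with ℕₚ.≤-<-connex x y
... | inj₁ x≤y = contradiction (trans (sym (≤⇒≤ᵇ≡true x≤y)) eq) λ ()
... | inj₂ y<x = y<x

≤ᵇ-⊔ : (x y p : ℕ) → ((x ⊔ y) ≤ᵇ p) ≡ (x ≤ᵇ p) ∧ (y ≤ᵇ p)
≤ᵇ-⊔ x y p with x ≤ᵇ p in x≤p | y ≤ᵇ p in y≤p
... | true  | true  = ≤⇒≤ᵇ≡true (ℕₚ.⊔-lub (≤ᵇ≡true⇒≤ x p x≤p) (≤ᵇ≡true⇒≤ y p y≤p))
... | false | _     = >⇒≤ᵇ≡false (ℕₚ.<-≤-trans (≤ᵇ≡false⇒> x p x≤p) (ℕₚ.m≤m⊔n x y))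
... | true  | false = >⇒≤ᵇ≡false (ℕₚ.<-≤-trans (≤ᵇ≡false⇒> y p y≤p) (ℕₚ.m≤n⊔m x y))

≤ᵇ-pred : (x y : ℕ) → 1 ≤ x → 1 ≤ y → (pred x ≤ᵇ pred y) ≡ (x ≤ᵇ y)
≤ᵇ-pred (suc x) (suc y) _ _ with x ≤ᵇ y in x≤y
... | true  = sym (≤⇒≤ᵇ≡true (s≤s (≤ᵇ≡true⇒≤ x y x≤y)))
... | false = sym (>⇒≤ᵇ≡false (s≤s (≤ᵇ≡false⇒> x y x≤y)))

positive : ℕ → Bool
positive zero    = false
positive (suc _) = true

positive-≥1 : {x : ℕ} → 1 ≤ x → positive x ≡ true
positive-≥1 {suc _} _ = refl

indicator : Bool → ℕ
indicator true  = 1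
indicator false = 0

count : (A → Bool) → List A → ℕ
count p []       = 0
count p (x ∷ xs) = indicator (p x) + count p xs

length-filterᵇ : (p : A → Bool) (xs : List A) → length (filterᵇ p xs) ≡ count p xs
length-filterᵇ p []       = refl
length-filterᵇ p (x ∷ xs) with p x
... | true  = cong suc (length-filterᵇ p xs)
... | false = length-filterᵇ p xs

∈-filterᵇ⁺ : (p : A → Bool) {x : A} {xs : List A} → x ∈ xs → p x ≡ true → x ∈ filterᵇ p xs
∈-filterᵇ⁺ p x∈xs px = ∈-filter⁺ (T? ∘ p) x∈xs (Equivalence.from Boolₚ.T-≡ px)

∈-filterᵇ⁻ : (p : A → Bool) (xs : List A) {x : A} → x ∈ filterᵇ p xs → x ∈ xs × p x ≡ true
∈-filterᵇ⁻ p xs x∈ with x∈xs , px ← ∈-filter⁻ (T? ∘ p) x∈ = x∈xs , Equivalence.to Boolₚ.T-≡ px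

∈-─ : {x z : A} (ys : List A) (x∈ys : x ∈ ys) → z ∈ ys → z ≢ x → z ∈ (ys ─ x∈ys)
∈-─ (y ∷ ys) (here refl) (here refl) z≢x = ⊥-elim (z≢x refl)
∈-─ (y ∷ ys) (here refl) (there z∈ys) _   = z∈ys
∈-─ (y ∷ ys) (there x∈ys) (here refl) _   = here refl
∈-─ (y ∷ ys) (there x∈ys) (there z∈ys) z≢x = there (∈-─ ys x∈ys z∈ys z≢x)

length-≤-injection : (h : A → B) {xs : List A} (ys : List B) → Unique xs →
  (∀ {x y} → x ∈ xs → y ∈ xs → h x ≡ h y → x ≡ y) →
  (∀ {x} → x ∈ xs → h x ∈ ys) → length xs ≤ length ys
length-≤-injection h {[]}     ys _ _ _ = z≤n
length-≤-injection h {x ∷ xs} ys (x∉xs ∷ !xs) inj maps =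
  subst (suc (length xs) ≤_) (sym (length-removeAt′ ys _))
    (s≤s (length-≤-injection h (ys ─ hx∈ys) !xs
      (λ u∈ v∈ → inj (there u∈) (there v∈))
      (λ z∈xs → ∈-─ ys hx∈ys (maps (there z∈xs))
        (λ hz≡hx → ListAll.lookup x∉xs z∈xs (inj (here refl) (there z∈xs) (sym hz≡hx))))))
  where hx∈ys = maps (here refl)

count-bijection : (f : A → B) (g : B → A) {p : A → Bool} {q : B → Bool} {xs : List A} {ys : List B} →
  Unique xs → Unique ys → (∀ x → g (f x) ≡ x) →
  (∀ {x} → x ∈ xs → p x ≡ true → f x ∈ ys × q (f x) ≡ true) →
  (∀ {y} → y ∈ ys → q y ≡ true → g y ∈ xs × p (g y) ≡ true × f (g y) ≡ y) →
  count p xs ≡ count q ys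
count-bijection f g {p} {q} {xs} {ys} !xs !ys gf forth back = ℕₚ.≤-antisym
  (subst₂ _≤_ (length-filterᵇ p xs) (length-filterᵇ q ys)
    (length-≤-injection f (filterᵇ q ys) (Uniqueₚ.filter⁺ (T? ∘ p) !xs)
      (λ {x} {y} _ _ fx≡fy → trans (sym (gf x)) (trans (cong g fx≡fy) (gf y)))
      (λ x∈ → let x∈xs , px = ∈-filterᵇ⁻ p xs x∈ ; fx∈ys , qfx = forth x∈xs px in ∈-filterᵇ⁺ q fx∈ys qfx)))
  (subst₂ _≤_ (length-filterᵇ q ys) (length-filterᵇ p xs)
    (length-≤-injection g (filterᵇ p xs) (Uniqueₚ.filter⁺ (T? ∘ q) !ys)
      (λ x∈ y∈ gx≡gy → trans (sym (fg x∈)) (trans (cong f gx≡gy) (fg y∈)))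
      (λ y∈ → let y∈ys , qy = ∈-filterᵇ⁻ q ys y∈ ; gy∈xs , pgy , _ = back y∈ys qy in ∈-filterᵇ⁺ p gy∈xs pgy)))
  where
  fg : ∀ {y} → y ∈ filterᵇ q ys → f (g y) ≡ y
  fg y∈ = let y∈ys , qy = ∈-filterᵇ⁻ q ys y∈ in proj₂ (proj₂ (back y∈ys qy))

count-cong : {p q : A → Bool} (xs : List A) → (∀ {x} → x ∈ xs → p x ≡ q x) → count p xs ≡ count q xs
count-cong []       p≗q = refl
count-cong (x ∷ xs) p≗q = cong₂ _+_ (cong indicator (p≗q (here refl))) (count-cong xs (p≗q ∘ there))

count-++ : (p : A → Bool) (xs ys : List A) → count p (xs ++ ys) ≡ count p xs + count p ys
count-++ p []       ys = refl
count-++ p (x ∷ xs) ys =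
  trans (cong (_+_ (indicator (p x))) (count-++ p xs ys)) (sym (ℕₚ.+-assoc (indicator (p x)) _ _))

count-map : (p : B → Bool) (f : A → B) (xs : List A) → count p (map f xs) ≡ count (p ∘ f) xs
count-map p f []       = refl
count-map p f (x ∷ xs) = cong (_+_ (indicator (p (f x)))) (count-map p f xs)

count-const-∧ : (b : Bool) (q : A → Bool) (xs : List A) → count (λ x → b ∧ q x) xs ≡ indicator b * count q xs
count-const-∧ true  q xs       = sym (ℕₚ.+-identityʳ _)
count-const-∧ false q []       = refl
count-const-∧ false q (x ∷ xs) = count-const-∧ false q xs

count-cartesianProductWith : (f : A → B → C) {r : C → Bool} (p : A → Bool) (q : B → Bool) →
  (∀ x y → r (f x y) ≡ p x ∧ q y) →
  (xs : List A) (ys : List B) → count r (cartesianProductWith f xs ys) ≡ count p xs * count q ys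
count-cartesianProductWith f {r} p q r≗ []       ys = refl
count-cartesianProductWith f {r} p q r≗ (x ∷ xs) ys = begin
  count r (map (f x) ys ++ cartesianProductWith f xs ys)      ≡⟨ count-++ r (map (f x) ys) _ ⟩
  count r (map (f x) ys) + count r (cartesianProductWith f xs ys)
    ≡⟨ cong₂ _+_ (trans (count-map r (f x) ys) (count-cong ys λ {y} _ → r≗ x y))
                 (count-cartesianProductWith f p q r≗ xs ys) ⟩
  count (λ y → p x ∧ q y) ys + count p xs * count q ys
    ≡⟨ cong (_+ count p xs * count q ys) (count-const-∧ (p x) q ys) ⟩
  indicator (p x) * count q ys + count p xs * count q ys
    ≡⟨ ℕₚ.*-distribʳ-+ (count q ys) (indicator (p x)) (count p xs) ⟨
  count p (x ∷ xs) * count q ys                               ∎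
  where open ≡-Reasoning

count-+-cong : {p q r s : A → Bool} (xs : List A) →
  (∀ {x} → x ∈ xs → indicator (p x) + indicator (q x) ≡ indicator (r x) + indicator (s x)) →
  count p xs + count q xs ≡ count r xs + count s xs
count-+-cong []                   _ = refl
count-+-cong {p = p} {q} {r} {s} (x ∷ xs) pq≗rs = begin
  (indicator (p x) + count p xs) + (indicator (q x) + count q xs)
    ≡⟨ interchange (indicator (p x)) (count p xs) (indicator (q x)) (count q xs) ⟩
  (indicator (p x) + indicator (q x)) + (count p xs + count q xs)
    ≡⟨ cong₂ _+_ (pq≗rs (here refl)) (count-+-cong xs (pq≗rs ∘ there)) ⟩
  (indicator (r x) + indicator (s x)) + (count r xs + count s xs)
    ≡⟨ interchange (indicator (r x)) (indicator (s x)) (count r xs) (count s xs) ⟩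
  (indicator (r x) + count r xs) + (indicator (s x) + count s xs) ∎
  where open ≡-Reasoning

allᵇ : {m : ℕ} → (A → Bool) → Vec A m → Bool
allᵇ p []       = true
allᵇ p (x ∷ xs) = p x ∧ allᵇ p xs

allᵇ-true : {m : ℕ} {p : A → Bool} → (∀ x → p x ≡ true) → (xs : Vec A m) → allᵇ p xs ≡ true
allᵇ-true p≡true []       = refl
allᵇ-true p≡true (x ∷ xs) = cong₂ _∧_ (p≡true x) (allᵇ-true p≡true xs)

allᵇ⁺ : {m : ℕ} {p : A → Bool} {xs : Vec A m} → AllV (λ x → p x ≡ true) xs → allᵇ p xs ≡ true
allᵇ⁺ []           = refl
allᵇ⁺ (px ∷ pxs) = ∧≡true⁺ px (allᵇ⁺ pxs)

allᵇ⁻ : {m : ℕ} {p : A → Bool} (xs : Vec A m) → allᵇ p xs ≡ true → AllV (λ x → p x ≡ true) xs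
allᵇ⁻ []       _   = []
allᵇ⁻ (x ∷ xs) all = let px , pxs = ∧≡true⁻ all in px ∷ allᵇ⁻ xs pxs

allᵇ-lookup : {m : ℕ} (p : A → Bool) (xs : Vec A m) → allᵇ p xs ≡ true → ∀ i → p (lookup xs i) ≡ true
allᵇ-lookup p xs all = AllVₚ.lookup⁺ (allᵇ⁻ xs all)

allᵇ-map : {m : ℕ} {p : B → Bool} {q : A → Bool} (f : A → B) → (∀ x → p (f x) ≡ q x) →
  (xs : Vec A m) → allᵇ p (Vec.map f xs) ≡ allᵇ q xs
allᵇ-map f pf≗q []       = refl
allᵇ-map f pf≗q (x ∷ xs) = cong₂ _∧_ (pf≗q x) (allᵇ-map f pf≗q xs)

allᵇ-∧ : {m : ℕ} (p q : A → Bool) (xs : Vec A m) → allᵇ (λ x → p x ∧ q x) xs ≡ allᵇ p xs ∧ allᵇ q xs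
allᵇ-∧ p q []       = refl
allᵇ-∧ p q (x ∷ xs) = trans (cong ((p x ∧ q x) ∧_) (allᵇ-∧ p q xs)) (∧-interchange (p x) (q x) _ _)

map-map-inverse : {m : ℕ} (f : A → B) (g : B → A) {ys : Vec B m} →
  AllV (λ y → f (g y) ≡ y) ys → Vec.map f (Vec.map g ys) ≡ ys
map-map-inverse f g []           = refl
map-map-inverse f g (fgy ∷ fgys) = cong₂ _∷_ fgy (map-map-inverse f g fgys)

tuples : (m : ℕ) → List A → List (Vec A m)
tuples zero    xs = [] ∷ []
tuples (suc m) xs = cartesianProductWith _∷_ xs (tuples m xs)

tuples-unique : (m : ℕ) {xs : List A} → Unique xs → Unique (tuples m xs)
tuples-unique zero    !xs = ListAll.[] ∷ []
tuples-unique (suc m) !xs = Uniqueₚ.cartesianProductWith⁺ _∷_ Vecₚ.∷-injective !xs (tuples-unique m !xs)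

∈-tuples⁺ : {m : ℕ} {xs : List A} {v : Vec A m} → AllV (_∈ xs) v → v ∈ tuples m xs
∈-tuples⁺ []             = here refl
∈-tuples⁺ (x∈xs ∷ v∈xs) = ∈-cartesianProductWith⁺ _∷_ x∈xs (∈-tuples⁺ v∈xs)

∈-tuples⁻ : {m : ℕ} {xs : List A} (v : Vec A m) → v ∈ tuples m xs → AllV (_∈ xs) v
∈-tuples⁻ {m = zero}  []      _ = []
∈-tuples⁻ {m = suc m} (x ∷ v) v∈
  with _ , _ , x′∈xs , v′∈ , eq ← ∈-cartesianProductWith⁻ _∷_ _ (tuples m _) v∈
  with refl , refl ← Vecₚ.∷-injective eq = x′∈xs ∷ ∈-tuples⁻ v v′∈

count-allᵇ-tuples : (p : A → Bool) (m : ℕ) (xs : List A) → count (allᵇ p) (tuples m xs) ≡ count p xs ^ m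
count-allᵇ-tuples p zero    xs = refl
count-allᵇ-tuples p (suc m) xs =
  trans (count-cartesianProductWith _∷_ p (allᵇ p) (λ _ _ → refl) xs (tuples m xs))
        (cong (count p xs *_) (count-allᵇ-tuples p m xs))

booleans : List Bool
booleans = true ∷ false ∷ []

booleans-unique : Unique booleans
booleans-unique = ((λ ()) ListAll.∷ ListAll.[]) ∷ ListAll.[] ∷ []

∈-booleans : (b : Bool) → b ∈ booleans
∈-booleans true  = here refl
∈-booleans false = there (here refl)

-- Chains in 2ⁿ × {0,…,l}

-- A row is an element of 2ⁿ × ℕ: a subset of Fin n as a bit vector, together with a label.
Row : ℕ → Set
Row n = Vec Bool n × ℕ

label : {n : ℕ} → Row n → ℕ
label = proj₂

rows : (n l : ℕ) → List (Row n)
rows n l = cartesianProduct (tuples n booleans) (downFrom (suc l))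

rows-unique : (n l : ℕ) → Unique (rows n l)
rows-unique n l = Uniqueₚ.cartesianProduct⁺ (tuples-unique n booleans-unique) (Uniqueₚ.downFrom⁺ (suc l))

∈-rows⁺ : {n l : ℕ} (r : Row n) → label r ≤ l → r ∈ rows n l
∈-rows⁺ (A , x) x≤l = ∈-cartesianProduct⁺ (∈-tuples⁺ (AllV.universal ∈-booleans A)) (∈-downFrom⁺ (s≤s x≤l))

∈-rows⁻ : {n l : ℕ} (r : Row n) → r ∈ rows n l → label r ≤ l
∈-rows⁻ {n} {l} (A , x) r∈ =
  ℕₚ.≤-pred (∈-downFrom⁻ (proj₂ (∈-cartesianProduct⁻ (tuples n booleans) (downFrom (suc l)) r∈)))

configurations : (m n l : ℕ) → List (Vec (Row n) m)
configurations m n l = tuples m (rows n l)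

configurations-unique : (m n l : ℕ) → Unique (configurations m n l)
configurations-unique m n l = tuples-unique m (rows-unique n l)

∈-configurations⁺ : {m n l : ℕ} (c : Vec (Row n) m) → AllV (λ r → label r ≤ l) c → c ∈ configurations m n l
∈-configurations⁺ c bounded = ∈-tuples⁺ (AllV.map (∈-rows⁺ _) bounded)

∈-configurations⁻ : {m n l : ℕ} (c : Vec (Row n) m) → c ∈ configurations m n l → AllV (λ r → label r ≤ l) c
∈-configurations⁻ c c∈ = AllV.map (∈-rows⁻ _) (∈-tuples⁻ c c∈)

_⊆ᵇ_ : {n : ℕ} → Vec Bool n → Vec Bool n → Bool
[]      ⊆ᵇ []      = true
(a ∷ A) ⊆ᵇ (b ∷ B) = (not a ∨ b) ∧ A ⊆ᵇ B

anyᵇ : {n : ℕ} → Vec Bool n → Bool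
anyᵇ []      = false
anyᵇ (a ∷ A) = a ∨ anyᵇ A

_≼ᵇ_ : {n : ℕ} → Row n → Row n → Bool
(A , x) ≼ᵇ (B , y) = (x ≤ᵇ y) ∧ A ⊆ᵇ B

comparableᵇ : {n : ℕ} → Row n → Row n → Bool
comparableᵇ r s = r ≼ᵇ s ∨ s ≼ᵇ r

nonzeroᵇ : {n : ℕ} → Row n → Bool
nonzeroᵇ (A , x) = anyᵇ A ∨ positive x

nonzeroChainᵇ : {m n : ℕ} → Vec (Row n) m → Bool
nonzeroChainᵇ []      = true
nonzeroChainᵇ (r ∷ c) = nonzeroᵇ r ∧ allᵇ (comparableᵇ r) c ∧ nonzeroChainᵇ c

chainCount : ℕ → ℕ → ℕ → ℕ
chainCount m n l = count nonzeroChainᵇ (configurations m n l)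

nonzeroChainᵇ-map : {m n n′ : ℕ} (f : Row n → Row n′) →
  (∀ r s → f r ≼ᵇ f s ≡ r ≼ᵇ s) → (∀ r → nonzeroᵇ (f r) ≡ nonzeroᵇ r) →
  (c : Vec (Row n) m) → nonzeroChainᵇ (Vec.map f c) ≡ nonzeroChainᵇ c
nonzeroChainᵇ-map f ≼-pres nonzero-pres []      = refl
nonzeroChainᵇ-map f ≼-pres nonzero-pres (r ∷ c) =
  cong₂ _∧_ (nonzero-pres r)
    (cong₂ _∧_ (allᵇ-map f (λ s → cong₂ _∨_ (≼-pres r s) (≼-pres s r)) c)
               (nonzeroChainᵇ-map f ≼-pres nonzero-pres c))

chainCount-transfer : (m l l′ : ℕ) {n n′ : ℕ} (f : Row n → Row n′) (g : Row n′ → Row n) (sep : Row n′ → Bool) →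
  (∀ r → g (f r) ≡ r) →
  (∀ r s → f r ≼ᵇ f s ≡ r ≼ᵇ s) → (∀ r → nonzeroᵇ (f r) ≡ nonzeroᵇ r) →
  (∀ {r} → r ∈ rows n l → f r ∈ rows n′ l′ × sep (f r) ≡ true) →
  (∀ {r} → r ∈ rows n′ l′ → sep r ≡ true → g r ∈ rows n l × f (g r) ≡ r) →
  chainCount m n l ≡ count (λ c → nonzeroChainᵇ c ∧ allᵇ sep c) (configurations m n′ l′)
chainCount-transfer m l l′ {n} {n′} f g sep gf ≼-pres nonzero-pres forth back =
  count-bijection (Vec.map f) (Vec.map g) (configurations-unique m n l) (configurations-unique m n′ l′)
    (λ c → trans (sym (Vecₚ.map-∘ g f c)) (trans (Vecₚ.map-cong gf c) (Vecₚ.map-id c)))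
    (λ {c} c∈ chain →
      let forthᶜ = AllV.map forth (∈-tuples⁻ c c∈) in
      ∈-tuples⁺ (AllVₚ.map⁺ (AllV.map proj₁ forthᶜ)) ,
      ∧≡true⁺ (trans (nonzeroChainᵇ-map f ≼-pres nonzero-pres c) chain)
              (trans (allᵇ-map f (λ _ → refl) c) (allᵇ⁺ (AllV.map proj₂ forthᶜ))))
    (λ {c} c∈ chain∧sep →
      let chain , sepᶜ = ∧≡true⁻ {nonzeroChainᵇ c} chain∧sep
          backᶜ = AllV.map (λ (r∈ , sepr) → back r∈ sepr) (AllV.zip (∈-tuples⁻ c c∈ , allᵇ⁻ c sepᶜ))
          fgc = map-map-inverse f g (AllV.map proj₂ backᶜ) in
      ∈-tuples⁺ (AllVₚ.map⁺ (AllV.map proj₁ backᶜ)) ,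
      trans (sym (nonzeroChainᵇ-map f ≼-pres nonzero-pres (Vec.map g c))) (trans (cong nonzeroChainᵇ fgc) chain) ,
      fgc)

comparableᵇ-Row0 : (r s : Row 0) → comparableᵇ r s ≡ true
comparableᵇ-Row0 ([] , x) ([] , y) with ℕₚ.≤-total x y
... | inj₁ x≤y rewrite ≤⇒≤ᵇ≡true x≤y = refl
... | inj₂ y≤x rewrite ≤⇒≤ᵇ≡true y≤x = Boolₚ.∨-zeroʳ _

nonzeroChainᵇ-Row0 : {m : ℕ} (c : Vec (Row 0) m) → nonzeroChainᵇ c ≡ allᵇ nonzeroᵇ c
nonzeroChainᵇ-Row0 []      = refl
nonzeroChainᵇ-Row0 (r ∷ c) =
  cong (nonzeroᵇ r ∧_) (cong₂ _∧_ (allᵇ-true (comparableᵇ-Row0 r) c) (nonzeroChainᵇ-Row0 c))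

count-positive-downFrom : (l : ℕ) → count positive (downFrom (suc l)) ≡ l
count-positive-downFrom zero    = refl
count-positive-downFrom (suc l) = cong suc (count-positive-downFrom l)

chainCount-zero : (m l : ℕ) → chainCount m 0 l ≡ l ^ m
chainCount-zero m l = begin
  count nonzeroChainᵇ (configurations m 0 l)  ≡⟨ count-cong (configurations m 0 l) (λ {c} _ → nonzeroChainᵇ-Row0 c) ⟩
  count (allᵇ nonzeroᵇ) (tuples m (rows 0 l)) ≡⟨ count-allᵇ-tuples nonzeroᵇ m (rows 0 l) ⟩
  count nonzeroᵇ (rows 0 l) ^ m               ≡⟨ cong (_^ m) nonzero-rows ⟩
  l ^ m                                       ∎
  where
  open ≡-Reasoning
  nonzero-rows : count nonzeroᵇ (rows 0 l) ≡ l
  nonzero-rows =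
    trans (count-cartesianProductWith _,_ (λ _ → true) positive (λ { [] _ → refl }) ([] ∷ []) (downFrom (suc l)))
          (trans (ℕₚ.+-identityʳ _) (count-positive-downFrom l))

-- The recurrence in n

-- Rows over suc n are upper (first bit set) or lower.  A chain is separated by the threshold p when its
-- lower labels are ≤ p and its upper labels are ≥ p.
module _ {n : ℕ} where

  separatesᵇ : ℕ → Row (suc n) → Bool
  separatesᵇ p (true  ∷ _ , x) = p ≤ᵇ x
  separatesᵇ p (false ∷ _ , x) = x ≤ᵇ p

  upperAboveᵇ : ℕ → Row (suc n) → Bool
  upperAboveᵇ p (true  ∷ _ , x) = p ≤ᵇ x
  upperAboveᵇ p (false ∷ _ , _) = true

  lowerMax : {m : ℕ} → Vec (Row (suc n)) m → ℕ
  lowerMax []                    = 0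
  lowerMax ((true  ∷ _ , _) ∷ c) = lowerMax c
  lowerMax ((false ∷ _ , x) ∷ c) = x ⊔ lowerMax c

  allᵇ-separatesᵇ : {m : ℕ} (p : ℕ) (c : Vec (Row (suc n)) m) →
    allᵇ (separatesᵇ p) c ≡ (lowerMax c ≤ᵇ p) ∧ allᵇ (upperAboveᵇ p) c
  allᵇ-separatesᵇ p []                    = refl
  allᵇ-separatesᵇ p ((true  ∷ _ , x) ∷ c) =
    trans (cong ((p ≤ᵇ x) ∧_) (allᵇ-separatesᵇ p c)) (∧-swap (p ≤ᵇ x) (lowerMax c ≤ᵇ p) _)
  allᵇ-separatesᵇ p ((false ∷ _ , x) ∷ c) = begin
    (x ≤ᵇ p) ∧ allᵇ (separatesᵇ p) c                          ≡⟨ cong ((x ≤ᵇ p) ∧_) (allᵇ-separatesᵇ p c) ⟩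
    (x ≤ᵇ p) ∧ ((lowerMax c ≤ᵇ p) ∧ allᵇ (upperAboveᵇ p) c)  ≡⟨ Boolₚ.∧-assoc (x ≤ᵇ p) _ _ ⟨
    ((x ≤ᵇ p) ∧ (lowerMax c ≤ᵇ p)) ∧ allᵇ (upperAboveᵇ p) c
      ≡⟨ cong (_∧ allᵇ (upperAboveᵇ p) c) (≤ᵇ-⊔ x (lowerMax c) p) ⟨
    ((x ⊔ lowerMax c) ≤ᵇ p) ∧ allᵇ (upperAboveᵇ p) c         ∎
    where open ≡-Reasoning

  upperAboveᵇ-zero : {m : ℕ} (c : Vec (Row (suc n)) m) → allᵇ (upperAboveᵇ 0) c ≡ true
  upperAboveᵇ-zero = allᵇ-true λ { (true ∷ _ , _) → refl ; (false ∷ _ , _) → refl }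

  upperAboveᵇ-antitone : {m : ℕ} {p q : ℕ} → p ≤ q → (c : Vec (Row (suc n)) m) →
    allᵇ (upperAboveᵇ q) c ≡ true → allᵇ (upperAboveᵇ p) c ≡ true
  upperAboveᵇ-antitone {p = p} {q} p≤q c above = allᵇ⁺ (AllV.map (λ {r} → step r) (allᵇ⁻ c above))
    where
    step : ∀ r → upperAboveᵇ q r ≡ true → upperAboveᵇ p r ≡ true
    step (true  ∷ _ , x) q≤x = ≤⇒≤ᵇ≡true (ℕₚ.≤-trans p≤q (≤ᵇ≡true⇒≤ _ x q≤x))
    step (false ∷ _ , _) _   = refl

  upperAboveᵇ-⊔ : {m : ℕ} (p q : ℕ) (c : Vec (Row (suc n)) m) →
    allᵇ (upperAboveᵇ p) c ≡ true → allᵇ (upperAboveᵇ q) c ≡ true → allᵇ (upperAboveᵇ (p ⊔ q)) c ≡ true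
  upperAboveᵇ-⊔ p q c above-p above-q =
    allᵇ⁺ (AllV.map (λ {r} → step r) (AllV.zip (allᵇ⁻ c above-p , allᵇ⁻ c above-q)))
    where
    step : ∀ r → upperAboveᵇ p r ≡ true × upperAboveᵇ q r ≡ true → upperAboveᵇ (p ⊔ q) r ≡ true
    step (true  ∷ _ , x) (p≤x , q≤x) = trans (≤ᵇ-⊔ p q x) (∧≡true⁺ p≤x q≤x)
    step (false ∷ _ , _) _           = refl

  -- An upper row is never below a lower one, so comparability forces lower ≼ upper.
  lower≤upper : (A B : Vec Bool n) (x y : ℕ) →
    comparableᵇ (false ∷ A , x) (true ∷ B , y) ≡ true → (x ≤ᵇ y) ≡ true
  lower≤upper A B x y comparable with x ≤ᵇ y
  ... | true  = refl
  ... | false = trans (sym (Boolₚ.∧-zeroʳ (y ≤ᵇ x))) comparable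

  comparable-lower⇒upperAbove : {m : ℕ} (A : Vec Bool n) (x : ℕ) (c : Vec (Row (suc n)) m) →
    allᵇ (comparableᵇ (false ∷ A , x)) c ≡ true → allᵇ (upperAboveᵇ x) c ≡ true
  comparable-lower⇒upperAbove A x c comparable = allᵇ⁺ (AllV.map (λ {s} → step s) (allᵇ⁻ c comparable))
    where
    step : ∀ s → comparableᵇ (false ∷ A , x) s ≡ true → upperAboveᵇ x s ≡ true
    step (false ∷ _ , _) _          = refl
    step (true  ∷ B , y) comparable = lower≤upper A B x y comparable

  comparable-upper⇒lowerMax≤ : {m : ℕ} (A : Vec Bool n) (y : ℕ) (c : Vec (Row (suc n)) m) →
    allᵇ (comparableᵇ (true ∷ A , y)) c ≡ true → (lowerMax c ≤ᵇ y) ≡ true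
  comparable-upper⇒lowerMax≤ A y []                    _ = refl
  comparable-upper⇒lowerMax≤ A y ((true  ∷ _ , _) ∷ c) comparable =
    comparable-upper⇒lowerMax≤ A y c (proj₂ (∧≡true⁻ comparable))
  comparable-upper⇒lowerMax≤ A y ((false ∷ B , x) ∷ c) comparable =
    let head , tail = ∧≡true⁻ comparable in
    trans (≤ᵇ-⊔ x (lowerMax c) y)
          (∧≡true⁺ (lower≤upper B A x y (trans (Boolₚ.∨-comm ((false ∷ B , x) ≼ᵇ (true ∷ A , y)) _) head))
                   (comparable-upper⇒lowerMax≤ A y c tail))

  chain⇒upperAbove-lowerMax : {m : ℕ} (c : Vec (Row (suc n)) m) →
    nonzeroChainᵇ c ≡ true → allᵇ (upperAboveᵇ (lowerMax c)) c ≡ true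
  chain⇒upperAbove-lowerMax []                    _     = refl
  chain⇒upperAbove-lowerMax ((true  ∷ A , y) ∷ c) chain =
    let _ , comparable∧chain = ∧≡true⁻ {nonzeroᵇ (true ∷ A , y)} chain
        comparable , chainᶜ  = ∧≡true⁻ comparable∧chain in
    ∧≡true⁺ (comparable-upper⇒lowerMax≤ A y c comparable) (chain⇒upperAbove-lowerMax c chainᶜ)
  chain⇒upperAbove-lowerMax ((false ∷ A , x) ∷ c) chain =
    let _ , comparable∧chain = ∧≡true⁻ {nonzeroᵇ (false ∷ A , x)} chain
        comparable , chainᶜ  = ∧≡true⁻ comparable∧chain in
    upperAboveᵇ-⊔ x (lowerMax c) c (comparable-lower⇒upperAbove A x c comparable)
                                   (chain⇒upperAbove-lowerMax c chainᶜ)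

module _ {n : ℕ} where

  cut : ℕ → Row n → Row (suc n)
  cut p (A , x) with suc p ≤ᵇ x
  ... | true  = true  ∷ A , pred x
  ... | false = false ∷ A , x

  uncut : Row (suc n) → Row n
  uncut (true  ∷ A , x) = A , suc x
  uncut (false ∷ A , x) = A , x

  uncut-cut : (p : ℕ) (r : Row n) → uncut (cut p r) ≡ r
  uncut-cut p (A , zero)  = refl
  uncut-cut p (A , suc x) with suc p ≤ᵇ suc x
  ... | true  = refl
  ... | false = refl

  cut-≼ᵇ : (p : ℕ) (r s : Row n) → cut p r ≼ᵇ cut p s ≡ r ≼ᵇ s
  cut-≼ᵇ p (A , x) (B , y) with suc p ≤ᵇ x in p<x | suc p ≤ᵇ y in p<y
  ... | true  | true  = cong (_∧ A ⊆ᵇ B) (≤ᵇ-pred x y (ℕₚ.≤-trans (s≤s z≤n) (≤ᵇ≡true⇒≤ _ x p<x))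
                                                    (ℕₚ.≤-trans (s≤s z≤n) (≤ᵇ≡true⇒≤ _ y p<y)))
  ... | true  | false rewrite >⇒≤ᵇ≡false (ℕₚ.≤-trans (≤ᵇ≡false⇒> _ y p<y) (≤ᵇ≡true⇒≤ _ x p<x)) = Boolₚ.∧-zeroʳ _
  ... | false | true
    rewrite ≤⇒≤ᵇ≡true (ℕₚ.≤-trans (ℕₚ.≤-pred (≤ᵇ≡false⇒> _ x p<x)) (ℕₚ.pred-mono-≤ (≤ᵇ≡true⇒≤ _ y p<y)))
          | ≤⇒≤ᵇ≡true (ℕₚ.≤-trans (ℕₚ.≤-pred (≤ᵇ≡false⇒> _ x p<x)) (ℕₚ.<⇒≤ (≤ᵇ≡true⇒≤ _ y p<y))) = refl
  ... | false | false = refl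

  cut-nonzeroᵇ : (p : ℕ) (r : Row n) → nonzeroᵇ (cut p r) ≡ nonzeroᵇ r
  cut-nonzeroᵇ p (A , x) with suc p ≤ᵇ x in p<x
  ... | true rewrite positive-≥1 (ℕₚ.≤-trans (s≤s z≤n) (≤ᵇ≡true⇒≤ _ x p<x)) = sym (Boolₚ.∨-zeroʳ _)
  ... | false = refl

  cut-separatesᵇ : (p : ℕ) (r : Row n) → separatesᵇ p (cut p r) ≡ true
  cut-separatesᵇ p (A , x) with suc p ≤ᵇ x in p<x
  ... | true  = ≤⇒≤ᵇ≡true (ℕₚ.pred-mono-≤ (≤ᵇ≡true⇒≤ _ x p<x))
  ... | false = ≤⇒≤ᵇ≡true (ℕₚ.≤-pred (≤ᵇ≡false⇒> _ x p<x))

  cut-label : {p l : ℕ} → p ≤ l → (r : Row n) → label r ≤ suc l → label (cut p r) ≤ l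
  cut-label {p} p≤l (A , x) x≤1+l with suc p ≤ᵇ x in p<x
  ... | true  = ℕₚ.pred-mono-≤ x≤1+l
  ... | false = ℕₚ.≤-trans (ℕₚ.≤-pred (≤ᵇ≡false⇒> _ x p<x)) p≤l

  cut-uncut : (p : ℕ) (r : Row (suc n)) → separatesᵇ p r ≡ true → cut p (uncut r) ≡ r
  cut-uncut p (true  ∷ A , x) p≤x rewrite ≤⇒≤ᵇ≡true (s≤s (≤ᵇ≡true⇒≤ p x p≤x)) = refl
  cut-uncut p (false ∷ A , x) x≤p rewrite >⇒≤ᵇ≡false (s≤s (≤ᵇ≡true⇒≤ x p x≤p)) = refl

  uncut-label : {l : ℕ} (r : Row (suc n)) → label r ≤ l → label (uncut r) ≤ suc l
  uncut-label (true  ∷ A , x) x≤l = s≤s x≤l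
  uncut-label (false ∷ A , x) x≤l = ℕₚ.m≤n⇒m≤1+n x≤l

  mark : ℕ → Row n → Row (suc n)
  mark q (A , x) = (suc q ≤ᵇ x) ∷ A , x

  unmark : Row (suc n) → Row n
  unmark (_ ∷ A , x) = A , x

  mark-≼ᵇ : (q : ℕ) (r s : Row n) → mark q r ≼ᵇ mark q s ≡ r ≼ᵇ s
  mark-≼ᵇ q (A , x) (B , y) = trans (sym (Boolₚ.∧-assoc (x ≤ᵇ y) _ _)) (cong (_∧ A ⊆ᵇ B) monotone)
    where
    monotone : (x ≤ᵇ y) ∧ (not (suc q ≤ᵇ x) ∨ (suc q ≤ᵇ y)) ≡ (x ≤ᵇ y)
    monotone with x ≤ᵇ y in x≤y
    ... | false = refl
    ... | true with suc q ≤ᵇ x in q<x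
    ...   | false = refl
    ...   | true rewrite ≤⇒≤ᵇ≡true (ℕₚ.≤-trans (≤ᵇ≡true⇒≤ _ x q<x) (≤ᵇ≡true⇒≤ x y x≤y)) = refl

  mark-nonzeroᵇ : (q : ℕ) (r : Row n) → nonzeroᵇ (mark q r) ≡ nonzeroᵇ r
  mark-nonzeroᵇ q (A , x) with suc q ≤ᵇ x in q<x
  ... | true rewrite positive-≥1 (ℕₚ.≤-trans (s≤s z≤n) (≤ᵇ≡true⇒≤ _ x q<x)) = sym (Boolₚ.∨-zeroʳ _)
  ... | false = refl

  mark-separatesᵇ : (q : ℕ) (r : Row n) → (separatesᵇ q (mark q r) ∧ separatesᵇ (suc q) (mark q r)) ≡ true
  mark-separatesᵇ q (A , x) with suc q ≤ᵇ x in q<x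
  ... | true  = ∧≡true⁺ (≤⇒≤ᵇ≡true (ℕₚ.<⇒≤ (≤ᵇ≡true⇒≤ _ x q<x))) q<x
  ... | false = ∧≡true⁺ (≤⇒≤ᵇ≡true (ℕₚ.≤-pred (≤ᵇ≡false⇒> _ x q<x)))
                        (≤⇒≤ᵇ≡true (ℕₚ.<⇒≤ (≤ᵇ≡false⇒> _ x q<x)))

  mark-unmark : (q : ℕ) (r : Row (suc n)) → (separatesᵇ q r ∧ separatesᵇ (suc q) r) ≡ true → mark q (unmark r) ≡ r
  mark-unmark q (true  ∷ A , x) separated = cong (λ b → b ∷ A , x) (proj₂ (∧≡true⁻ separated))
  mark-unmark q (false ∷ A , x) separated =
    cong (λ b → b ∷ A , x) (>⇒≤ᵇ≡false (s≤s (≤ᵇ≡true⇒≤ x q (proj₁ (∧≡true⁻ separated)))))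

chainCount-cut : (m n l : ℕ) {p : ℕ} → p ≤ l →
  chainCount m n (suc l) ≡ count (λ c → nonzeroChainᵇ c ∧ allᵇ (separatesᵇ p) c) (configurations m (suc n) l)
chainCount-cut m n l {p} p≤l =
  chainCount-transfer m (suc l) l (cut p) uncut (separatesᵇ p) (uncut-cut p) (cut-≼ᵇ p) (cut-nonzeroᵇ p)
    (λ {r} r∈ → ∈-rows⁺ (cut p r) (cut-label p≤l r (∈-rows⁻ r r∈)) , cut-separatesᵇ p r)
    (λ {r} r∈ separated → ∈-rows⁺ (uncut r) (uncut-label r (∈-rows⁻ r r∈)) , cut-uncut p r separated)

chainCount-mark : (m n l q : ℕ) →
  chainCount m n l ≡ count (λ c → nonzeroChainᵇ c ∧ allᵇ (λ r → separatesᵇ q r ∧ separatesᵇ (suc q) r) c)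
                           (configurations m (suc n) l)
chainCount-mark m n l q =
  chainCount-transfer m l l (mark q) unmark (λ r → separatesᵇ q r ∧ separatesᵇ (suc q) r)
    (λ _ → refl) (mark-≼ᵇ q) (mark-nonzeroᵇ q)
    (λ {r} r∈ → ∈-rows⁺ (mark q r) (∈-rows⁻ r r∈) , mark-separatesᵇ q r)
    (λ { {_ ∷ A , x} r∈ separated → ∈-rows⁺ (A , x) (∈-rows⁻ _ r∈) , mark-unmark q _ separated })

lowerMax-≤ : {m n l : ℕ} (c : Vec (Row (suc n)) m) → AllV (λ r → label r ≤ l) c → lowerMax c ≤ l
lowerMax-≤ []                    []               = z≤n
lowerMax-≤ ((true  ∷ _ , _) ∷ c) (_ ∷ bounded)   = lowerMax-≤ c bounded
lowerMax-≤ ((false ∷ _ , _) ∷ c) (x≤l ∷ bounded) = ℕₚ.⊔-lub x≤l (lowerMax-≤ c bounded)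

-- With s the largest lower label and u₀, u₁ saying that the upper labels are ≥ q, ≥ q + 1.
indicator-threshold-step : (s q : ℕ) (u₀ u₁ : Bool) → (u₁ ≡ true → u₀ ≡ true) → (s ≡ suc q → u₁ ≡ true) →
  indicator (s ≤ᵇ suc q) + indicator (((s ≤ᵇ q) ∧ u₀) ∧ ((s ≤ᵇ suc q) ∧ u₁))
    ≡ indicator (s ≤ᵇ q) + indicator ((s ≤ᵇ suc q) ∧ u₁)
indicator-threshold-step s q u₀ u₁ u₁⇒u₀ s≡1+q⇒u₁ with ℕₚ.≤-<-connex s q
... | inj₁ s≤q rewrite ≤⇒≤ᵇ≡true s≤q | ≤⇒≤ᵇ≡true (ℕₚ.m≤n⇒m≤1+n s≤q) with u₁
...   | true  rewrite u₁⇒u₀ refl = refl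
...   | false rewrite Boolₚ.∧-zeroʳ u₀ = refl
indicator-threshold-step s q u₀ u₁ u₁⇒u₀ s≡1+q⇒u₁ | inj₂ q<s with ℕₚ.m≤n⇒m<n∨m≡n q<s
... | inj₂ refl rewrite >⇒≤ᵇ≡false (ℕₚ.n<1+n q) | ≤⇒≤ᵇ≡true (ℕₚ.≤-refl {suc q}) | s≡1+q⇒u₁ refl = refl
... | inj₁ 1+q<s rewrite >⇒≤ᵇ≡false q<s | >⇒≤ᵇ≡false 1+q<s = refl

module ChainCountRecurrence (m n l : ℕ) where

  chainsWith : (Vec (Row (suc n)) m → Bool) → ℕ
  chainsWith p = count (λ c → nonzeroChainᵇ c ∧ p c) (configurations m (suc n) l)

  lowerAtMost : ℕ → ℕ
  lowerAtMost q = chainsWith λ c → lowerMax c ≤ᵇ q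

  separatedAt : ℕ → ℕ
  separatedAt p = chainsWith (allᵇ (separatesᵇ p))

  lowerAtMost-step : (q : ℕ) → lowerAtMost (suc q) + chainCount m n l ≡ lowerAtMost q + separatedAt (suc q)
  lowerAtMost-step q = trans (cong (_+_ (lowerAtMost (suc q))) (chainCount-mark m n l q))
    (count-+-cong (configurations m (suc n) l) λ {c} _ → pointwise c)
    where
    pointwise : ∀ c →
      indicator (nonzeroChainᵇ c ∧ (lowerMax c ≤ᵇ suc q))
        + indicator (nonzeroChainᵇ c ∧ allᵇ (λ r → separatesᵇ q r ∧ separatesᵇ (suc q) r) c)
      ≡ indicator (nonzeroChainᵇ c ∧ (lowerMax c ≤ᵇ q))
        + indicator (nonzeroChainᵇ c ∧ allᵇ (separatesᵇ (suc q)) c)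
    pointwise c with nonzeroChainᵇ c in chain
    ... | false = refl
    ... | true rewrite allᵇ-∧ (separatesᵇ q) (separatesᵇ (suc q)) c
                     | allᵇ-separatesᵇ q c | allᵇ-separatesᵇ (suc q) c =
      indicator-threshold-step (lowerMax c) q _ _ (upperAboveᵇ-antitone (ℕₚ.n≤1+n q) c)
        (λ s≡1+q → subst (λ t → allᵇ (upperAboveᵇ t) c ≡ true) s≡1+q (chain⇒upperAbove-lowerMax c chain))

  lowerAtMost-zero : lowerAtMost 0 ≡ separatedAt 0
  lowerAtMost-zero = count-cong (configurations m (suc n) l) λ {c} _ →
    cong (nonzeroChainᵇ c ∧_)
      (sym (trans (allᵇ-separatesᵇ 0 c)
                  (trans (cong ((lowerMax c ≤ᵇ 0) ∧_) (upperAboveᵇ-zero c)) (Boolₚ.∧-identityʳ _))))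

  lowerAtMost-top : lowerAtMost l ≡ chainCount m (suc n) l
  lowerAtMost-top = count-cong (configurations m (suc n) l) λ {c} c∈ →
    trans (cong (nonzeroChainᵇ c ∧_) (≤⇒≤ᵇ≡true (lowerMax-≤ c (∈-configurations⁻ c c∈)))) (Boolₚ.∧-identityʳ _)

  lowerAtMost-closedForm : (q : ℕ) → q ≤ l → lowerAtMost q + q * chainCount m n l ≡ suc q * chainCount m n (suc l)
  lowerAtMost-closedForm zero    _     = begin
    lowerAtMost 0 + 0           ≡⟨ ℕₚ.+-identityʳ _ ⟩
    lowerAtMost 0               ≡⟨ lowerAtMost-zero ⟩
    separatedAt 0               ≡⟨ chainCount-cut m n l z≤n ⟨
    chainCount m n (suc l)      ≡⟨ ℕₚ.+-identityʳ _ ⟨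
    1 * chainCount m n (suc l)  ∎
    where open ≡-Reasoning
  lowerAtMost-closedForm (suc q) 1+q≤l = begin
    lowerAtMost (suc q) + (Y + q * Y)  ≡⟨ ℕₚ.+-assoc (lowerAtMost (suc q)) Y (q * Y) ⟨
    lowerAtMost (suc q) + Y + q * Y    ≡⟨ cong (_+ q * Y) (lowerAtMost-step q) ⟩
    lowerAtMost q + separatedAt (suc q) + q * Y
      ≡⟨ cong (λ t → lowerAtMost q + t + q * Y) (chainCount-cut m n l 1+q≤l) ⟨
    lowerAtMost q + Y′ + q * Y         ≡⟨ xy∙z≈xz∙y (lowerAtMost q) Y′ (q * Y) ⟩
    lowerAtMost q + q * Y + Y′         ≡⟨ cong (_+ Y′) (lowerAtMost-closedForm q (ℕₚ.<⇒≤ 1+q≤l)) ⟩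
    suc q * Y′ + Y′                    ≡⟨ ℕₚ.+-comm (suc q * Y′) Y′ ⟩
    suc (suc q) * Y′                   ∎
    where
    open ≡-Reasoning
    Y  = chainCount m n l
    Y′ = chainCount m n (suc l)

chainCount-suc : (m n l : ℕ) → chainCount m (suc n) l + l * chainCount m n l ≡ suc l * chainCount m n (suc l)
chainCount-suc m n l =
  trans (cong (_+ l * chainCount m n l) (sym lowerAtMost-top)) (lowerAtMost-closedForm l ℕₚ.≤-refl)
  where open ChainCountRecurrence m n l

-- Acyclic orientations as chains of rows

size : {n : ℕ} → Vec Bool n → ℕ
size []      = 0
size (a ∷ A) = indicator a + size A

⊆ᵇ-refl : {n : ℕ} (A : Vec Bool n) → A ⊆ᵇ A ≡ true
⊆ᵇ-refl []          = refl
⊆ᵇ-refl (true  ∷ A) = ⊆ᵇ-refl A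
⊆ᵇ-refl (false ∷ A) = ⊆ᵇ-refl A

⊆ᵇ-lookup : {n : ℕ} (A B : Vec Bool n) → A ⊆ᵇ B ≡ true → ∀ j → lookup A j ≡ true → lookup B j ≡ true
⊆ᵇ-lookup (true ∷ A) (true  ∷ B) _  zero    _ = refl
⊆ᵇ-lookup (true ∷ A) (false ∷ B) () zero    _
⊆ᵇ-lookup (a ∷ A)    (b ∷ B)     A⊆B (suc j) Aj = ⊆ᵇ-lookup A B (proj₂ (∧≡true⁻ {not a ∨ b} A⊆B)) j Aj

⊈ᵇ-witness : {n : ℕ} (A B : Vec Bool n) → A ⊆ᵇ B ≡ false →
  Σ (Fin n) λ j → lookup A j ≡ true × lookup B j ≡ false
⊈ᵇ-witness []          []          ()
⊈ᵇ-witness (true  ∷ A) (false ∷ B) _   = zero , refl , refl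
⊈ᵇ-witness (true  ∷ A) (true  ∷ B) A⊈B = let j , Aj , ¬Bj = ⊈ᵇ-witness A B A⊈B in suc j , Aj , ¬Bj
⊈ᵇ-witness (false ∷ A) (b     ∷ B) A⊈B = let j , Aj , ¬Bj = ⊈ᵇ-witness A B A⊈B in suc j , Aj , ¬Bj

anyᵇ-witness : {n : ℕ} (A : Vec Bool n) → anyᵇ A ≡ true → Σ (Fin n) λ j → lookup A j ≡ true
anyᵇ-witness (true  ∷ A) _   = zero , refl
anyᵇ-witness (false ∷ A) any = let j , Aj = anyᵇ-witness A any in suc j , Aj

anyᵇ-false : {n : ℕ} (A : Vec Bool n) → anyᵇ A ≡ false → ∀ j → lookup A j ≡ false
anyᵇ-false (false ∷ A) _    zero    = refl
anyᵇ-false (false ∷ A) none (suc j) = anyᵇ-false A none j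

size-mono : {n : ℕ} (A B : Vec Bool n) → A ⊆ᵇ B ≡ true → size A ≤ size B
size-mono []          []          _   = z≤n
size-mono (true  ∷ A) (true  ∷ B) A⊆B = s≤s (size-mono A B A⊆B)
size-mono (false ∷ A) (true  ∷ B) A⊆B = ℕₚ.m≤n⇒m≤1+n (size-mono A B A⊆B)
size-mono (false ∷ A) (false ∷ B) A⊆B = size-mono A B A⊆B

size-strict : {n : ℕ} (A B : Vec Bool n) → A ⊆ᵇ B ≡ true →
  ∀ j → lookup A j ≡ false → lookup B j ≡ true → size A < size B
size-strict (false ∷ A) (true  ∷ B) A⊆B zero    _   _  = s≤s (size-mono A B A⊆B)
size-strict (true  ∷ A) (true  ∷ B) A⊆B (suc j) ¬Aj Bj = s≤s (size-strict A B A⊆B j ¬Aj Bj)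
size-strict (false ∷ A) (true  ∷ B) A⊆B (suc j) ¬Aj Bj = ℕₚ.m≤n⇒m≤1+n (size-strict A B A⊆B j ¬Aj Bj)
size-strict (false ∷ A) (false ∷ B) A⊆B (suc j) ¬Aj Bj = size-strict A B A⊆B j ¬Aj Bj

≼ᵇ-refl : {n : ℕ} (r : Row n) → r ≼ᵇ r ≡ true
≼ᵇ-refl (A , x) rewrite ≤⇒≤ᵇ≡true (ℕₚ.≤-refl {x}) = ⊆ᵇ-refl A

nonzeroChainᵇ⁻ : {m n : ℕ} (c : Vec (Row n) m) → nonzeroChainᵇ c ≡ true →
  (∀ i → nonzeroᵇ (lookup c i) ≡ true) × (∀ i i′ → comparableᵇ (lookup c i) (lookup c i′) ≡ true)
nonzeroChainᵇ⁻ []      _     = (λ ()) , (λ ())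
nonzeroChainᵇ⁻ (r ∷ c) chain =
  let nonzero , comparable∧chain = ∧≡true⁻ {nonzeroᵇ r} chain
      comparable , chainᶜ         = ∧≡true⁻ comparable∧chain
      nonzeroᶜ , comparableᶜ      = nonzeroChainᵇ⁻ c chainᶜ in
  (λ { zero → nonzero ; (suc i) → nonzeroᶜ i }) ,
  (λ { zero    zero     → cong (_∨ (r ≼ᵇ r)) (≼ᵇ-refl r)
     ; zero    (suc i′) → allᵇ-lookup (comparableᵇ r) c comparable i′
     ; (suc i) zero     → trans (Boolₚ.∨-comm (lookup c i ≼ᵇ r) (r ≼ᵇ lookup c i))
                                (allᵇ-lookup (comparableᵇ r) c comparable i)
     ; (suc i) (suc i′) → comparableᶜ i i′ })

nonzeroChainᵇ⁺ : {m n : ℕ} (c : Vec (Row n) m) → (∀ i → nonzeroᵇ (lookup c i) ≡ true) →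
  (∀ i i′ → comparableᵇ (lookup c i) (lookup c i′) ≡ true) → nonzeroChainᵇ c ≡ true
nonzeroChainᵇ⁺ []      _       _          = refl
nonzeroChainᵇ⁺ (r ∷ c) nonzero comparable =
  ∧≡true⁺ (nonzero zero)
    (∧≡true⁺ (allᵇ⁺ {p = comparableᵇ r} {c} (AllVₚ.lookup⁻ (comparable zero ∘ suc)))
             (nonzeroChainᵇ⁺ c (nonzero ∘ suc) (λ i i′ → comparable (suc i) (suc i′))))

module _ {m n : ℕ} (o : Orientation m n) where

  private
    row : Fin m → Vec Bool n
    row = lookup o

  RowsComparable : Set
  RowsComparable = ∀ i i′ → (row i ⊆ᵇ row i′ ∨ row i′ ⊆ᵇ row i) ≡ true

  RowsNonempty : Set
  RowsNonempty = ∀ i → anyᵇ (row i) ≡ true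

  -- j lies in row i but not in row i′, so comparability forces row i′ ⊊ row i.
  size-two-step : RowsComparable → ∀ {i j i′} → Arc o (inj₁ i) (inj₂ j) → Arc o (inj₂ j) (inj₁ i′) →
    size (row i′) < size (row i)
  size-two-step comparable {i} {j} {i′} i→j j→i′ with row i ⊆ᵇ row i′ in i⊆i′
  ... | true  = contradiction (trans (sym (⊆ᵇ-lookup (row i) (row i′) i⊆i′ j i→j)) j→i′) λ ()
  ... | false = size-strict (row i′) (row i) i′⊆i j j→i′ i→j
    where i′⊆i = subst (λ b → (b ∨ row i′ ⊆ᵇ row i) ≡ true) i⊆i′ (comparable i i′)

  size-decreasing-walk : RowsComparable → ∀ {x y} → TransClosure (Arc o) x y →
    ∀ {i i′} → ReflClosure (Arc o) (inj₁ i) x → ReflClosure (Arc o) y (inj₁ i′) → size (row i′) < size (row i)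
  size-decreasing-walk comparable {inj₁ _} {inj₁ _} [ () ]
  size-decreasing-walk comparable {inj₂ _} {inj₂ _} [ () ]
  size-decreasing-walk comparable {inj₁ _} {inj₂ _} [ i→j ] Refl.refl Refl.[ j→i′ ] = size-two-step comparable i→j j→i′
  size-decreasing-walk comparable {inj₁ _} {inj₂ _} [ _ ]   Refl.[ () ] _
  size-decreasing-walk comparable {inj₂ _} {inj₁ _} [ j→i′ ] Refl.[ i→j ] Refl.refl  = size-two-step comparable i→j j→i′
  size-decreasing-walk comparable {inj₂ _} {inj₁ _} [ _ ]   _ Refl.[ () ]
  size-decreasing-walk comparable {inj₁ _} (_∷_ {y = inj₁ _} () _)
  size-decreasing-walk comparable {inj₂ _} (_∷_ {y = inj₂ _} () _)
  size-decreasing-walk comparable {inj₁ _} (_∷_ {y = inj₂ _} i→j j⇝y) Refl.refl     y→i′ =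
    size-decreasing-walk comparable j⇝y Refl.[ i→j ] y→i′
  size-decreasing-walk comparable {inj₁ _} (_∷_ {y = inj₂ _} _ _)     Refl.[ () ] _
  size-decreasing-walk comparable {inj₂ _} (_∷_ {y = inj₁ _} j→i″ i″⇝y) Refl.[ i→j ] y→i′ =
    ℕₚ.<-trans (size-decreasing-walk comparable i″⇝y Refl.refl y→i′) (size-two-step comparable i→j j→i″)

  comparable⇒acyclic : RowsComparable → Acyclic o
  comparable⇒acyclic comparable (inj₁ i) cycle =
    ℕₚ.<-irrefl refl (size-decreasing-walk comparable cycle Refl.refl Refl.refl)
  comparable⇒acyclic comparable (inj₂ j) [ () ]
  comparable⇒acyclic comparable (inj₂ j) (_∷_ {y = inj₂ _} () _)
  comparable⇒acyclic comparable (inj₂ j) (_∷_ {y = inj₁ _} j→i i⇝j) =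
    ℕₚ.<-irrefl refl (size-decreasing-walk comparable i⇝j Refl.refl Refl.[ j→i ])

  acyclic⇒comparable : Acyclic o → RowsComparable
  acyclic⇒comparable acyclic i i′ with row i ⊆ᵇ row i′ in i⊆i′ | row i′ ⊆ᵇ row i in i′⊆i
  ... | true  | _     = refl
  ... | false | true  = refl
  ... | false | false =
    let j  , i→j  , j→i′ = ⊈ᵇ-witness (row i) (row i′) i⊆i′
        j′ , i′→j′ , j′→i = ⊈ᵇ-witness (row i′) (row i) i′⊆i in
    ⊥-elim (acyclic (inj₁ i) (_∷_ {y = inj₂ j} i→j (_∷_ {y = inj₁ i′} j→i′ (_∷_ {y = inj₂ j′} i′→j′ [ j′→i ]))))

  nonempty⇒noSinkInL : RowsNonempty → NoSinkInL o
  nonempty⇒noSinkInL nonempty i sink = let j , i→j = anyᵇ-witness (row i) (nonempty i) in sink (inj₂ j) i→j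

  noSinkInL⇒nonempty : NoSinkInL o → RowsNonempty
  noSinkInL⇒nonempty noSink i with anyᵇ (row i) in any
  ... | true  = refl
  ... | false = ⊥-elim (noSink i λ
    { (inj₁ _) ()
    ; (inj₂ j) i→j → contradiction (trans (sym i→j) (anyᵇ-false (row i) any j)) λ () })

  asRows : Vec (Row n) m
  asRows = Vec.map (_, 0) o

  inRᵇ : Bool
  inRᵇ = nonzeroChainᵇ asRows

  private
    lookup-asRows : ∀ i → lookup asRows i ≡ (row i , 0)
    lookup-asRows i = Vecₚ.lookup-map i (_, 0) o

  inRᵇ-sound : inRᵇ ≡ true → InR o
  inRᵇ-sound chain =
    let nonzero , comparable = nonzeroChainᵇ⁻ asRows chain in
    comparable⇒acyclic (λ i i′ →
      subst (_≡ true) (cong₂ comparableᵇ (lookup-asRows i) (lookup-asRows i′)) (comparable i i′)) ,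
    nonempty⇒noSinkInL (λ i →
      trans (sym (Boolₚ.∨-identityʳ _)) (subst (λ r → nonzeroᵇ r ≡ true) (lookup-asRows i) (nonzero i)))

  inRᵇ-complete : InR o → inRᵇ ≡ true
  inRᵇ-complete (acyclic , noSink) = nonzeroChainᵇ⁺ asRows
    (λ i → subst (λ r → nonzeroᵇ r ≡ true) (sym (lookup-asRows i))
             (trans (Boolₚ.∨-identityʳ _) (noSinkInL⇒nonempty noSink i)))
    (λ i i′ → subst (_≡ true) (sym (cong₂ comparableᵇ (lookup-asRows i) (lookup-asRows i′)))
                (acyclic⇒comparable acyclic i i′))

orientations : (m n : ℕ) → List (Orientation m n)
orientations m n = tuples m (tuples n booleans)

orientations-unique : (m n : ℕ) → Unique (orientations m n)
orientations-unique m n = tuples-unique m (tuples-unique n booleans-unique)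

∈-orientations : {m n : ℕ} (o : Orientation m n) → o ∈ orientations m n
∈-orientations o = ∈-tuples⁺ (AllV.universal (λ A → ∈-tuples⁺ (AllV.universal ∈-booleans A)) o)

count-inRᵇ : (m n : ℕ) → count inRᵇ (orientations m n) ≡ chainCount m n 0
count-inRᵇ m n =
  count-bijection (Vec.map (_, 0)) (Vec.map proj₁) (orientations-unique m n) (configurations-unique m n 0)
  (λ o → trans (sym (Vecₚ.map-∘ proj₁ (_, 0) o)) (Vecₚ.map-id o))
  (λ {o} _ chain → ∈-configurations⁺ (Vec.map (_, 0) o) (AllVₚ.map⁺ (AllV.universal (λ _ → z≤n) o)) , chain)
  (λ {c} c∈ chain →
    let labels0 = map-map-inverse (_, 0) proj₁ (AllV.map (λ {r} x≤0 → cong (proj₁ r ,_) (sym (ℕₚ.n≤0⇒n≡0 x≤0)))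
                                                      (∈-configurations⁻ c c∈)) in
    ∈-orientations (Vec.map proj₁ c) , trans (cong nonzeroChainᵇ labels0) chain , labels0)

-- Solving the recurrence

Δ : (ℕ → ℤ) → ℕ → ℤ
Δ h l = + suc l ℤ.* h (suc l) ℤ.- + l ℤ.* h l

Δ^ : ℕ → (ℕ → ℤ) → ℕ → ℤ
Δ^ zero    h = h
Δ^ (suc n) h = Δ (Δ^ n h)

Δ^-suc : (n : ℕ) (h : ℕ → ℤ) (l : ℕ) → Δ^ (suc n) h l ≡ Δ^ n (Δ h) l
Δ^-suc zero    h l = refl
Δ^-suc (suc n) h l = cong₂ (λ a b → + suc l ℤ.* a ℤ.- + l ℤ.* b) (Δ^-suc n h (suc l)) (Δ^-suc n h l)

chainCount≡Δ^ : (m n l : ℕ) → + chainCount m n l ≡ Δ^ n (λ k → + k ^ m) l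
chainCount≡Δ^ m zero    l = cong +_ (chainCount-zero m l)
chainCount≡Δ^ m (suc n) l = begin
  + a                                   ≡⟨ add-sub (+ a) (+ l ℤ.* + b) ⟩
  (+ a ℤ.+ + l ℤ.* + b) ℤ.- + l ℤ.* + b ≡⟨ cong (ℤ._- + l ℤ.* + b) pos-a+lb ⟨
  + (a + l * b) ℤ.- + l ℤ.* + b         ≡⟨ cong (λ t → + t ℤ.- + l ℤ.* + b) (chainCount-suc m n l) ⟩
  + (suc l * c) ℤ.- + l ℤ.* + b         ≡⟨ cong (ℤ._- + l ℤ.* + b) (ℤₚ.pos-* (suc l) c) ⟩
  + suc l ℤ.* + c ℤ.- + l ℤ.* + b
    ≡⟨ cong₂ (λ u v → + suc l ℤ.* u ℤ.- + l ℤ.* v) (chainCount≡Δ^ m n (suc l)) (chainCount≡Δ^ m n l) ⟩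
  Δ^ (suc n) (λ k → + k ^ m) l          ∎
  where
  open ≡-Reasoning
  a = chainCount m (suc n) l
  b = chainCount m n l
  c = chainCount m n (suc l)
  add-sub : ∀ x y → x ≡ (x ℤ.+ y) ℤ.- y
  add-sub = solve-∀
  pos-a+lb : + (a + l * b) ≡ + a ℤ.+ + l ℤ.* + b
  pos-a+lb = trans (ℤₚ.pos-+ a (l * b)) (cong (λ t → + a ℤ.+ t) (ℤₚ.pos-* l b))

sumℤ-cong : (N : ℕ) {f g : ℕ → ℤ} → (∀ {k} → k < N → f k ≡ g k) → sumℤ N f ≡ sumℤ N g
sumℤ-cong zero    f≗g = refl
sumℤ-cong (suc N) f≗g = cong₂ ℤ._+_ (sumℤ-cong N (f≗g ∘ ℕₚ.m<n⇒m<1+n)) (f≗g (ℕₚ.n<1+n N))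

sumℤ-shift : (N : ℕ) (f : ℕ → ℤ) → sumℤ (suc N) f ≡ f 0 ℤ.+ sumℤ N (f ∘ suc)
sumℤ-shift zero    f = trans (ℤₚ.+-identityˡ (f 0)) (sym (ℤₚ.+-identityʳ (f 0)))
sumℤ-shift (suc N) f = trans (cong (ℤ._+ f (suc N)) (sumℤ-shift N f)) (ℤₚ.+-assoc (f 0) _ _)

sumℤ-+ : (N : ℕ) (f g : ℕ → ℤ) → sumℤ N (λ k → f k ℤ.+ g k) ≡ sumℤ N f ℤ.+ sumℤ N g
sumℤ-+ zero    f g = refl
sumℤ-+ (suc N) f g =
  trans (cong (ℤ._+ (f N ℤ.+ g N)) (sumℤ-+ N f g)) (interchangeℤ (sumℤ N f) (sumℤ N g) (f N) (g N))
  where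
  interchangeℤ : ∀ a b c d → (a ℤ.+ b) ℤ.+ (c ℤ.+ d) ≡ (a ℤ.+ c) ℤ.+ (b ℤ.+ d)
  interchangeℤ = solve-∀

sumℤ-neg : (N : ℕ) (f : ℕ → ℤ) → sumℤ N (λ k → ℤ.- f k) ≡ ℤ.- sumℤ N f
sumℤ-neg zero    f = refl
sumℤ-neg (suc N) f = trans (cong (ℤ._- f N) (sumℤ-neg N f)) (sym (ℤₚ.neg-distrib-+ (sumℤ N f) (f N)))

sumℤ-telescope : (N : ℕ) (g : ℕ → ℤ) → sumℤ N (λ k → g k ℤ.- g (suc k)) ≡ g 0 ℤ.- g N
sumℤ-telescope zero    g = sym (ℤₚ.+-inverseʳ (g 0))
sumℤ-telescope (suc N) g =
  trans (cong (ℤ._+ (g N ℤ.- g (suc N))) (sumℤ-telescope N g)) (ℤₚ.+-minus-telescope (g 0) (g N) (g (suc N)))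

sumℤ-reverse : (N : ℕ) (f : ℕ → ℤ) → sumℤ N f ≡ sumℤ N (λ i → f (N ∸ suc i))
sumℤ-reverse zero    f = refl
sumℤ-reverse (suc N) f = begin
  sumℤ N f ℤ.+ f N                                  ≡⟨ cong (ℤ._+ f N) (sumℤ-reverse N f) ⟩
  sumℤ N (λ i → f (N ∸ suc i)) ℤ.+ f N              ≡⟨ ℤₚ.+-comm _ (f N) ⟩
  f N ℤ.+ sumℤ N (λ i → f (N ∸ suc i))              ≡⟨ sumℤ-shift N (λ i → f (suc N ∸ suc i)) ⟨
  sumℤ (suc N) (λ i → f (suc N ∸ suc i))            ∎
  where open ≡-Reasoning

stirling2-above : (n k : ℕ) → n < k → stirling2 n k ≡ 0
stirling2-above zero    (suc k) _ = refl
stirling2-above (suc n) (suc k) (s≤s n<k)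
  rewrite stirling2-above n (suc k) (ℕₚ.m<n⇒m<1+n n<k) | stirling2-above n k n<k =
    trans (ℕₚ.+-identityʳ _) (ℕₚ.*-zeroʳ k)

stirling2-diagonal : (n : ℕ) → stirling2 n n ≡ 1
stirling2-diagonal zero    = refl
stirling2-diagonal (suc n) rewrite stirling2-above n (suc n) (ℕₚ.n<1+n n) | stirling2-diagonal n =
  cong (_+ 1) (ℕₚ.*-zeroʳ n)

sign : ℕ → ℤ
sign k = ℤ.-1ℤ ℤ.^ k

sign-+ : (a b : ℕ) → sign (a + b) ≡ sign a ℤ.* sign b
sign-+ = ℤₚ.^-distribˡ-+-* ℤ.-1ℤ

sign-square : (j : ℕ) → sign j ℤ.* sign j ≡ + 1
sign-square zero    = refl
sign-square (suc j) = trans (identity (sign j)) (sign-square j)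
  where
  identity : ∀ s → (ℤ.-1ℤ ℤ.* s) ℤ.* (ℤ.-1ℤ ℤ.* s) ≡ s ℤ.* s
  identity = solve-∀

sign-double : (j : ℕ) → sign (j + j) ≡ + 1
sign-double j = trans (sign-+ j j) (sign-square j)

-- (-1)^(n-k) S(n,k) k!, with the sign written as (-1)^(n+k) to avoid truncated subtraction.
signedStirling : ℕ → ℕ → ℤ
signedStirling n k = sign (n + k) ℤ.* + (stirling2 n k * k !)

signedStirling-suc : (n k : ℕ) →
  signedStirling (suc n) (suc k) ≡ + suc k ℤ.* signedStirling n k ℤ.- + suc k ℤ.* signedStirling n (suc k)
signedStirling-suc n k = begin
  sign (suc n + suc k) ℤ.* + ((suc k * S₁ + S₀) * (suc k * k !))
    ≡⟨ cong₂ ℤ._*_ (cong (λ t → ℤ.-1ℤ ℤ.* sign t) (ℕₚ.+-suc n k)) casts ⟩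
  ℤ.-1ℤ ℤ.* (ℤ.-1ℤ ℤ.* sign (n + k)) ℤ.* ((+ suc k ℤ.* + S₁ ℤ.+ + S₀) ℤ.* (+ suc k ℤ.* + (k !)))
    ≡⟨ identity (sign (n + k)) (+ suc k) (+ S₁) (+ S₀) (+ (k !)) ⟩
  + suc k ℤ.* (sign (n + k) ℤ.* (+ S₀ ℤ.* + (k !)))
    ℤ.- + suc k ℤ.* (ℤ.-1ℤ ℤ.* sign (n + k) ℤ.* (+ S₁ ℤ.* (+ suc k ℤ.* + (k !))))
    ≡⟨ cong₂ (λ a b → + suc k ℤ.* (sign (n + k) ℤ.* a) ℤ.- + suc k ℤ.* (sign (suc (n + k)) ℤ.* b))
             (sym (ℤₚ.pos-* S₀ (k !)))
             (trans (cong (+ S₁ ℤ.*_) (sym (ℤₚ.pos-* (suc k) (k !)))) (sym (ℤₚ.pos-* S₁ (suc k !)))) ⟩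
  + suc k ℤ.* signedStirling n k ℤ.- + suc k ℤ.* (sign (suc (n + k)) ℤ.* + (S₁ * suc k !))
    ≡⟨ cong (λ t → + suc k ℤ.* signedStirling n k ℤ.- + suc k ℤ.* (sign t ℤ.* + (S₁ * suc k !))) (ℕₚ.+-suc n k) ⟨
  + suc k ℤ.* signedStirling n k ℤ.- + suc k ℤ.* signedStirling n (suc k) ∎
  where
  open ≡-Reasoning
  S₀ = stirling2 n k
  S₁ = stirling2 n (suc k)
  casts : + ((suc k * S₁ + S₀) * (suc k * k !)) ≡ (+ suc k ℤ.* + S₁ ℤ.+ + S₀) ℤ.* (+ suc k ℤ.* + (k !))
  casts = trans (ℤₚ.pos-* (suc k * S₁ + S₀) (suc k * k !))
                (cong₂ ℤ._*_ (trans (ℤₚ.pos-+ (suc k * S₁) S₀) (cong (ℤ._+ + S₀) (ℤₚ.pos-* (suc k) S₁)))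
                             (ℤₚ.pos-* (suc k) (k !)))
  identity : ∀ s K a b F → ℤ.-1ℤ ℤ.* (ℤ.-1ℤ ℤ.* s) ℤ.* ((K ℤ.* a ℤ.+ b) ℤ.* (K ℤ.* F))
                          ≡ K ℤ.* (s ℤ.* (b ℤ.* F)) ℤ.- K ℤ.* (ℤ.-1ℤ ℤ.* s ℤ.* (a ℤ.* (K ℤ.* F)))
  identity = solve-∀

signedStirling-zero : (n : ℕ) → signedStirling (suc n) 0 ≡ + 0
signedStirling-zero n = ℤₚ.*-zeroʳ (sign (suc n + 0))

signedStirling-above : (n : ℕ) → signedStirling n (suc n) ≡ + 0
signedStirling-above n rewrite stirling2-above n (suc n) (ℕₚ.n<1+n n) = ℤₚ.*-zeroʳ (sign (n + suc n))

stirlingTransform : ℕ → (ℕ → ℤ) → ℤ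
stirlingTransform n h = sumℤ (suc n) (λ k → signedStirling n k ℤ.* h k)

-- The Pascal-type recurrence of the coefficients turns one application of Δ into a telescoping sum.
stirlingTransform-suc : (n : ℕ) (h : ℕ → ℤ) → stirlingTransform (suc n) h ≡ stirlingTransform n (Δ h)
stirlingTransform-suc n h = begin
  stirlingTransform (suc n) h
    ≡⟨ sumℤ-shift (suc n) _ ⟩
  signedStirling (suc n) 0 ℤ.* h 0 ℤ.+ sumℤ (suc n) (λ k → signedStirling (suc n) (suc k) ℤ.* h (suc k))
    ≡⟨ cong (λ t → t ℤ.* h 0 ℤ.+ sumℤ (suc n) (λ k → signedStirling (suc n) (suc k) ℤ.* h (suc k)))
            (signedStirling-zero n) ⟩
  + 0 ℤ.+ sumℤ (suc n) (λ k → signedStirling (suc n) (suc k) ℤ.* h (suc k))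
    ≡⟨ ℤₚ.+-identityˡ _ ⟩
  sumℤ (suc n) (λ k → signedStirling (suc n) (suc k) ℤ.* h (suc k))
    ≡⟨ sumℤ-cong (suc n) (λ {k} _ → pointwise k) ⟩
  sumℤ (suc n) (λ k → signedStirling n k ℤ.* Δ h k ℤ.+ (g k ℤ.- g (suc k)))
    ≡⟨ sumℤ-+ (suc n) _ _ ⟩
  stirlingTransform n (Δ h) ℤ.+ sumℤ (suc n) (λ k → g k ℤ.- g (suc k))
    ≡⟨ cong (ℤ._+_ (stirlingTransform n (Δ h))) (sumℤ-telescope (suc n) g) ⟩
  stirlingTransform n (Δ h) ℤ.+ (+ 0 ℤ.- g (suc n))
    ≡⟨ cong (λ t → stirlingTransform n (Δ h) ℤ.+ (+ 0 ℤ.- + suc n ℤ.* t ℤ.* h (suc n))) (signedStirling-above n) ⟩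
  stirlingTransform n (Δ h) ℤ.+ (+ 0 ℤ.- + suc n ℤ.* + 0 ℤ.* h (suc n))
    ≡⟨ cong (λ t → stirlingTransform n (Δ h) ℤ.+ (+ 0 ℤ.- t ℤ.* h (suc n))) (ℤₚ.*-zeroʳ (+ suc n)) ⟩
  stirlingTransform n (Δ h) ℤ.+ + 0
    ≡⟨ ℤₚ.+-identityʳ _ ⟩
  stirlingTransform n (Δ h) ∎
  where
  open ≡-Reasoning
  g : ℕ → ℤ
  g k = + k ℤ.* signedStirling n k ℤ.* h k
  identity : ∀ K k e₀ e₁ h₀ h₁ → (K ℤ.* e₀ ℤ.- K ℤ.* e₁) ℤ.* h₁
                                 ≡ e₀ ℤ.* (K ℤ.* h₁ ℤ.- k ℤ.* h₀) ℤ.+ (k ℤ.* e₀ ℤ.* h₀ ℤ.- K ℤ.* e₁ ℤ.* h₁)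
  identity = solve-∀
  pointwise : ∀ k → signedStirling (suc n) (suc k) ℤ.* h (suc k) ≡ signedStirling n k ℤ.* Δ h k ℤ.+ (g k ℤ.- g (suc k))
  pointwise k = trans (cong (ℤ._* h (suc k)) (signedStirling-suc n k))
                      (identity (+ suc k) (+ k) (signedStirling n k) (signedStirling n (suc k)) (h k) (h (suc k)))

Δ^-at-zero : (n : ℕ) (h : ℕ → ℤ) → Δ^ n h 0 ≡ stirlingTransform n h
Δ^-at-zero zero    h = sym (trans (ℤₚ.+-identityˡ _) (ℤₚ.*-identityˡ (h 0)))
Δ^-at-zero (suc n) h = trans (Δ^-suc n h 0) (trans (Δ^-at-zero n (Δ h)) (sym (stirlingTransform-suc n h)))

-- With n = i + j, the exponent (n + 1) + j = (i + 1) + 2j has the parity of i + 1.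
sign-complement : {i n : ℕ} → i ≤ n → sign (suc n + (n ∸ i)) ≡ ℤ.- sign i
sign-complement {i} {n} i≤n = begin
  sign (suc n + j)               ≡⟨ cong (λ t → sign (suc t + j)) (ℕₚ.m+[n∸m]≡n i≤n) ⟨
  sign (suc i + j + j)           ≡⟨ cong sign (ℕₚ.+-assoc (suc i) j j) ⟩
  sign (suc i + (j + j))         ≡⟨ sign-+ (suc i) (j + j) ⟩
  sign (suc i) ℤ.* sign (j + j)  ≡⟨ cong (sign (suc i) ℤ.*_) (sign-double j) ⟩
  sign (suc i) ℤ.* + 1           ≡⟨ ℤₚ.*-identityʳ (sign (suc i)) ⟩
  ℤ.-1ℤ ℤ.* sign i               ≡⟨ ℤₚ.neg-distribˡ-* (+ 1) (sign i) ⟨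
  ℤ.- (+ 1 ℤ.* sign i)           ≡⟨ cong ℤ.-_ (ℤₚ.*-identityˡ (sign i)) ⟩
  ℤ.- sign i                     ∎
  where
  open ≡-Reasoning
  j = n ∸ i

stirlingTransform-power : (m n : ℕ) → stirlingTransform (suc n) (λ k → + (k ^ m)) ≡ formula m (suc n)
stirlingTransform-power m n = begin
  stirlingTransform (suc n) power
    ≡⟨ sumℤ-shift (suc n) _ ⟩
  signedStirling (suc n) 0 ℤ.* power 0 ℤ.+ sumℤ (suc n) term
    ≡⟨ cong (λ t → t ℤ.* power 0 ℤ.+ sumℤ (suc n) term) (signedStirling-zero n) ⟩
  + 0 ℤ.+ sumℤ (suc n) term
    ≡⟨ ℤₚ.+-identityˡ _ ⟩
  sumℤ n term ℤ.+ term n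
    ≡⟨ cong₂ ℤ._+_ (sumℤ-reverse n term) top ⟩
  sumℤ n (λ i → term (n ∸ suc i)) ℤ.+ + (suc n ! * suc n ^ m)
    ≡⟨ cong (ℤ._+ + (suc n ! * suc n ^ m)) (trans (sumℤ-cong n reflected) (sumℤ-neg n summand)) ⟩
  ℤ.- sumℤ n summand ℤ.+ + (suc n ! * suc n ^ m)
    ≡⟨ ℤₚ.+-comm (ℤ.- sumℤ n summand) _ ⟩
  formula m (suc n) ∎
  where
  open ≡-Reasoning
  power : ℕ → ℤ
  power k = + (k ^ m)
  term : ℕ → ℤ
  term k = signedStirling (suc n) (suc k) ℤ.* power (suc k)
  summand : ℕ → ℤ
  summand i = sign i ℤ.* + ((n ∸ i) ! * (n ∸ i) ^ m * stirling2 (suc n) (n ∸ i))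
  top : term n ≡ + (suc n ! * suc n ^ m)
  top = begin
    sign (suc n + suc n) ℤ.* + (stirling2 (suc n) (suc n) * suc n !) ℤ.* power (suc n)
      ≡⟨ cong₂ (λ s S → s ℤ.* + (S * suc n !) ℤ.* power (suc n)) (sign-double (suc n)) (stirling2-diagonal (suc n)) ⟩
    + 1 ℤ.* + (1 * suc n !) ℤ.* + (suc n ^ m)
      ≡⟨ cong (λ t → t ℤ.* + (suc n ^ m)) (trans (ℤₚ.*-identityˡ _) (cong +_ (ℕₚ.*-identityˡ (suc n !)))) ⟩
    + (suc n !) ℤ.* + (suc n ^ m)
      ≡⟨ ℤₚ.pos-* (suc n !) (suc n ^ m) ⟨
    + (suc n ! * suc n ^ m) ∎
  identity : ∀ s S F P → ℤ.- s ℤ.* (S ℤ.* F) ℤ.* P ≡ ℤ.- (s ℤ.* (F ℤ.* P ℤ.* S))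
  identity = solve-∀
  reflected : ∀ {i} → i < n → term (n ∸ suc i) ≡ ℤ.- summand i
  reflected {i} i<n = begin
    signedStirling (suc n) (suc (n ∸ suc i)) ℤ.* power (suc (n ∸ suc i))
      ≡⟨ cong (λ k → signedStirling (suc n) k ℤ.* power k) (ℕₚ.+-∸-assoc 1 i<n) ⟨
    sign (suc n + j) ℤ.* + (S * j !) ℤ.* + (j ^ m)
      ≡⟨ cong₂ (λ s t → s ℤ.* t ℤ.* + (j ^ m)) (sign-complement (ℕₚ.<⇒≤ i<n)) (ℤₚ.pos-* S (j !)) ⟩
    ℤ.- sign i ℤ.* (+ S ℤ.* + (j !)) ℤ.* + (j ^ m)
      ≡⟨ identity (sign i) (+ S) (+ (j !)) (+ (j ^ m)) ⟩
    ℤ.- (sign i ℤ.* (+ (j !) ℤ.* + (j ^ m) ℤ.* + S))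
      ≡⟨ cong (λ t → ℤ.- (sign i ℤ.* t)) casts ⟨
    ℤ.- summand i ∎
    where
    j = n ∸ i
    S = stirling2 (suc n) j
    casts : + (j ! * j ^ m * S) ≡ + (j !) ℤ.* + (j ^ m) ℤ.* + S
    casts = trans (ℤₚ.pos-* (j ! * j ^ m) S) (cong (ℤ._* + S) (ℤₚ.pos-* (j !) (j ^ m)))

theorem6p2 : (m n : ℕ) → 1 ≤ n →
    Σ (List (Orientation m n)) (λ xs →
      Unique xs × ((o : Orientation m n) → (o ∈ xs ⇔ InR o)) × (+ length xs ≡ formula m n))
theorem6p2 m (suc n) _ =
  filterᵇ inRᵇ (orientations m (suc n)) ,
  Uniqueₚ.filter⁺ (T? ∘ inRᵇ) (orientations-unique m (suc n)) ,
  (λ o → mk⇔ (inRᵇ-sound o ∘ proj₂ ∘ ∈-filterᵇ⁻ inRᵇ (orientations m (suc n)))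
             (∈-filterᵇ⁺ inRᵇ (∈-orientations o) ∘ inRᵇ-complete o)) ,
  (begin
    + length (filterᵇ inRᵇ (orientations m (suc n)))  ≡⟨ cong +_ (length-filterᵇ inRᵇ (orientations m (suc n))) ⟩
    + count inRᵇ (orientations m (suc n))             ≡⟨ cong +_ (count-inRᵇ m (suc n)) ⟩
    + chainCount m (suc n) 0                          ≡⟨ chainCount≡Δ^ m (suc n) 0 ⟩
    Δ^ (suc n) (λ k → + (k ^ m)) 0                    ≡⟨ Δ^-at-zero (suc n) (λ k → + (k ^ m)) ⟩
    stirlingTransform (suc n) (λ k → + (k ^ m))       ≡⟨ stirlingTransform-power m n ⟩
    formula m (suc n)                                 ∎)
  where open ≡-Reasoning
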